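{- Let $p$ be a propositional variable. There is no formula $\varphi\in\mathsf L_{\mathsf R}$ such that $\Diamond p\leftrightarrow\varphi$ is valid over the class of persistent models.
   Context: $\mathsf L_{\mathsf R}$: formulas built from variables and $\bot$ using $\wedge,\vee,\to,\bigcirc,\mathsf R$. A persistent model is $(W,\preccurlyeq,S,V)$ with $\preccurlyeq$ a partial order on nonempty $W$, $S\colon W\to W$ forward confluent ($w\preccurlyeq v\Rightarrow S(w)\preccurlyeq S(v)$) and backward confluent (if $v\succcurlyeq S(w)$ then there is $u\succcurlyeq w$ with $S(u)=v$), and monotone $V\colon W\to\mathcal P(\mathbb P)$. Satisfaction: atoms by $V$; $\bot$ false; $\wedge,\vee$ classical; $w\models\bigcirc\varphi$ iff $S(w)\models\varphi$; $w\models\varphi\to\psi$ iff every $v\succcurlyeq w$ with $v\models\varphi$ has $v\models\psi$; $w\models\Diamond\varphi$ iff $S^k(w)\models\varphi$ for some $k\ge0$; $w\models\varphi\,\mathsf R\,\psi$ iff for all $k\ge0$, $S^k(w)\models\psi$ or $S^i(w)\models\varphi$ for some $i\in[0,k)$. -}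

module Defs where

open import Data.Nat using (ℕ; zero; suc; _<_; _≤_)
open import Data.Product using (Σ; _×_; _,_; ∃-syntax)
open import Data.Sum using (_⊎_)
open import Data.Empty using (⊥)
open import Data.Unit using (⊤)
open import Relation.Binary.PropositionalEquality using (_≡_)

Var : Set
Var = ℕ

data Fm : Set where
  var  : Var → Fm
  ⊥'   : Fm
  _∧'_ : Fm → Fm → Fm
  _∨'_ : Fm → Fm → Fm
  _⇒_  : Fm → Fm → Fm
  ○_   : Fm → Fm
  ◇_   : Fm → Fm
  _R_  : Fm → Fm → Fm

_⇔'_ : Fm → Fm → Fm
φ ⇔' ψ = (φ ⇒ ψ) ∧' (ψ ⇒ φ)

data InLR : Fm → Set where
  var  : ∀ x → InLR (var x)
  ⊥'   : InLR ⊥'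
  _∧'_ : ∀ {φ ψ} → InLR φ → InLR ψ → InLR (φ ∧' ψ)
  _∨'_ : ∀ {φ ψ} → InLR φ → InLR ψ → InLR (φ ∨' ψ)
  _⇒_  : ∀ {φ ψ} → InLR φ → InLR ψ → InLR (φ ⇒ ψ)
  ○_   : ∀ {φ} → InLR φ → InLR (○ φ)
  _R_  : ∀ {φ ψ} → InLR φ → InLR ψ → InLR (φ R ψ)

iter : {W : Set} → (W → W) → ℕ → W → W
iter S zero    w = w
iter S (suc k) w = S (iter S k w)

record PersistentModel : Set₁ where
  field
    W       : Set
    inhabited : W
    _≼_     : W → W → Set
    ≼-refl  : ∀ {w} → w ≼ w
    ≼-trans : ∀ {u v w} → u ≼ v → v ≼ w → u ≼ w
    ≼-antisym : ∀ {u v} → u ≼ v → v ≼ u → u ≡ v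
    S       : W → W
    fwd-conf : ∀ {w v} → w ≼ v → S w ≼ S v
    bwd-conf : ∀ {w v} → S w ≼ v → Σ W (λ u → (w ≼ u) × (S u ≡ v))
    V       : W → Var → Set
    V-mono  : ∀ {w v x} → w ≼ v → V w x → V v x

module _ (M : PersistentModel) where
  open PersistentModel M

  _⊨_ : W → Fm → Set
  w ⊨ var x    = V w x
  w ⊨ ⊥'       = ⊥
  w ⊨ (φ ∧' ψ) = (w ⊨ φ) × (w ⊨ ψ)
  w ⊨ (φ ∨' ψ) = (w ⊨ φ) ⊎ (w ⊨ ψ)
  w ⊨ (φ ⇒ ψ)  = ∀ v → w ≼ v → v ⊨ φ → v ⊨ ψ
  w ⊨ (○ φ)    = S w ⊨ φ
  w ⊨ (◇ φ)    = Σ ℕ (λ k → iter S k w ⊨ φ)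
  w ⊨ (φ R ψ)  = ∀ k → (iter S k w ⊨ ψ) ⊎ Σ ℕ (λ i → (i < k) × (iter S i w ⊨ φ))

Valid : Fm → Set₁
Valid φ = (M : PersistentModel) → (w : PersistentModel.W M) → _⊨_ M w φ

-- Take the points ∞ < ⋯ < 2 < 1 < 0, with S the predecessor map on ℕ fixing ∞, and let every
-- variable hold exactly at 0.  Then ◇p holds at every natural number but not at ∞.  An L_R formula
-- cannot carve out this set: by induction on formulas, each one is true either everywhere or exactly
-- on an initial segment {0, …, n−1}.  The case of R is where ◇ and R part ways: every definable set
-- is closed under S, so φ R ψ is equivalent to ψ in this model.
module Submission where

open import Defs
open import Data.Empty using (⊥; ⊥-elim)
open import Data.Nat using (ℕ; zero; suc; pred; _∸_; _≤_; _<_; _⊓_; _⊔_; _<?_; z≤n; s≤s; z<s; s≤s⁻¹)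
open import Data.Nat.Properties
  using (≤-refl; ≤-trans; ≤-antisym; ≤-<-trans; <-≤-trans; <-irrefl; ≮⇒≥; n≤0⇒n≡0; pred-mono-≤; pred[n]≤n;
         n∸n≡0; pred[m∸n]≡m∸[1+n]; ⊓-glb; m<n⊓o⇒m<n; m<n⊓o⇒m<o; m<n⇒m<n⊔o; m<n⇒m<o⊔n; ⊔-sel)
open import Data.Product using (Σ; _×_; _,_; proj₁; proj₂)
open import Data.Sum using (_⊎_; inj₁; inj₂; [_,_])
open import Data.Unit using (⊤; tt)
open import Data.Product.Function.NonDependent.Propositional using (_×-⇔_)
open import Data.Sum.Function.Propositional using (_⊎-⇔_)
open import Function.Bundles using (_⇔_; mk⇔; Equivalence)
open import Function.Construct.Composition using (_⇔-∘_)
open import Relation.Binary.PropositionalEquality using (_≡_; refl; sym; trans; cong; subst)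
open import Relation.Nullary using (¬_; yes; no)

open Equivalence using (to; from)

valid-⇔'-pointwise : ∀ {φ ψ} → Valid (φ ⇔' ψ) →
                     (M : PersistentModel) → ∀ w → _⊨_ M w φ ⇔ _⊨_ M w ψ
valid-⇔'-pointwise valid M w =
  mk⇔ (λ w⊨φ → proj₁ (valid M w) w ≼-refl w⊨φ) (λ w⊨ψ → proj₂ (valid M w) w ≼-refl w⊨ψ)
  where open PersistentModel M using (≼-refl)

<-⊔-split : ∀ {d} m n → d < m ⊔ n → d < m ⊎ d < n
<-⊔-split m n d<m⊔n with ⊔-sel m n
... | inj₁ m⊔n≡m = inj₁ (subst (_ <_) m⊔n≡m d<m⊔n)
... | inj₂ m⊔n≡n = inj₂ (subst (_ <_) m⊔n≡n d<m⊔n)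

data Point : Set where
  ∞   : Point
  fin : ℕ → Point

data _≼_ : Point → Point → Set where
  ∞≼   : ∀ {w} → ∞ ≼ w
  fin≼ : ∀ {d e} → e ≤ d → fin d ≼ fin e

≼-refl : ∀ {w} → w ≼ w
≼-refl {∞}     = ∞≼
≼-refl {fin d} = fin≼ ≤-refl

≼-trans : ∀ {u v w} → u ≼ v → v ≼ w → u ≼ w
≼-trans ∞≼       _        = ∞≼
≼-trans (fin≼ p) (fin≼ q) = fin≼ (≤-trans q p)

≼-antisym : ∀ {u v} → u ≼ v → v ≼ u → u ≡ v
≼-antisym ∞≼       ∞≼       = refl
≼-antisym (fin≼ p) (fin≼ q) = cong fin (≤-antisym q p)

step : Point → Point
step ∞       = ∞
step (fin d) = fin (pred d)

step-mono : ∀ {w v} → w ≼ v → step w ≼ step v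
step-mono ∞≼       = ∞≼
step-mono (fin≼ p) = fin≼ (pred-mono-≤ p)

step-lift : ∀ {w v} → step w ≼ v → Σ Point (λ u → (w ≼ u) × (step u ≡ v))
step-lift {∞}           {∞}     _        = ∞ , ∞≼ , refl
step-lift {∞}           {fin e} _        = fin (suc e) , ∞≼ , refl
step-lift {fin zero}    {fin e} (fin≼ p) = fin zero , fin≼ z≤n , cong fin (sym (n≤0⇒n≡0 p))
step-lift {fin (suc d)} {fin e} (fin≼ p) = fin (suc e) , fin≼ (s≤s p) , refl

IsZero : Point → Set
IsZero ∞       = ⊥
IsZero (fin d) = d ≡ 0

IsZero-upward : ∀ {w v} → w ≼ v → IsZero w → IsZero v
IsZero-upward (fin≼ p) refl = n≤0⇒n≡0 p

countdown : PersistentModel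
countdown = record
  { W = Point ; inhabited = ∞
  ; _≼_ = _≼_ ; ≼-refl = ≼-refl ; ≼-trans = ≼-trans ; ≼-antisym = ≼-antisym
  ; S = step ; fwd-conf = step-mono ; bwd-conf = step-lift
  ; V = λ w _ → IsZero w ; V-mono = IsZero-upward }

_⊩_ : Point → Fm → Set
_⊩_ = _⊨_ countdown

iter-step-∞ : ∀ k → iter step k ∞ ≡ ∞
iter-step-∞ zero    = refl
iter-step-∞ (suc k) = cong step (iter-step-∞ k)

iter-step-fin : ∀ k d → iter step k (fin d) ≡ fin (d ∸ k)
iter-step-fin zero    d = refl
iter-step-fin (suc k) d = trans (cong step (iter-step-fin k d)) (cong fin (pred[m∸n]≡m∸[1+n] d k))

◇-var-at-fin : ∀ p d → fin d ⊩ (◇ var p)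
◇-var-at-fin p d = d , subst IsZero (sym (iter-step-fin d d)) (n∸n≡0 d)

¬◇-var-at-∞ : ∀ p → ¬ (∞ ⊩ (◇ var p))
¬◇-var-at-∞ p (k , Sᵏ∞⊩p) = subst IsZero (iter-step-∞ k) Sᵏ∞⊩p

data Region : Set where
  everywhere : Region
  below      : ℕ → Region

_∈_ : Point → Region → Set
w     ∈ everywhere = ⊤
∞     ∈ below n    = ⊥
fin d ∈ below n    = d < n

∈-upward : ∀ r {w v} → w ≼ v → w ∈ r → v ∈ r
∈-upward everywhere _        _   = tt
∈-upward (below n)  (fin≼ p) e<n = ≤-<-trans p e<n

∈-step : ∀ r w → w ∈ r → step w ∈ r
∈-step everywhere _       _   = tt
∈-step (below n)  (fin d) d<n = ≤-<-trans pred[n]≤n d<n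

∈-iter-step : ∀ r k w → w ∈ r → iter step k w ∈ r
∈-iter-step r zero    w w∈r = w∈r
∈-iter-step r (suc k) w w∈r = ∈-step r (iter step k w) (∈-iter-step r k w w∈r)

∈-below-or-≼ : ∀ n w → w ∈ below n ⊎ w ≼ fin n
∈-below-or-≼ n ∞ = inj₂ ∞≼
∈-below-or-≼ n (fin d) with d <? n
... | yes d<n = inj₁ d<n
... | no  d≮n = inj₂ (fin≼ (≮⇒≥ d≮n))

_∩_ : Region → Region → Region
everywhere ∩ r         = r
below m    ∩ everywhere = below m
below m    ∩ below n    = below (m ⊓ n)

∈-∩ : ∀ r s w → (w ∈ r × w ∈ s) ⇔ w ∈ (r ∩ s)
∈-∩ everywhere s          w       = mk⇔ proj₂ (tt ,_)
∈-∩ (below m)  everywhere w       = mk⇔ proj₁ (_, tt)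
∈-∩ (below m)  (below n)  ∞       = mk⇔ (λ ()) (λ ())
∈-∩ (below m)  (below n)  (fin d) =
  mk⇔ (λ (d<m , d<n) → ⊓-glb d<m d<n) (λ d<m⊓n → m<n⊓o⇒m<n m n d<m⊓n , m<n⊓o⇒m<o m n d<m⊓n)

_∪_ : Region → Region → Region
everywhere ∪ s          = everywhere
below m    ∪ everywhere = everywhere
below m    ∪ below n    = below (m ⊔ n)

∈-∪ : ∀ r s w → (w ∈ r ⊎ w ∈ s) ⇔ w ∈ (r ∪ s)
∈-∪ everywhere s          w       = mk⇔ (λ _ → tt) inj₁
∈-∪ (below m)  everywhere w       = mk⇔ (λ _ → tt) inj₂
∈-∪ (below m)  (below n)  ∞       = mk⇔ [ (λ ()) , (λ ()) ] (λ ())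
∈-∪ (below m)  (below n)  (fin d) = mk⇔ [ m<n⇒m<n⊔o n , m<n⇒m<o⊔n m ] (<-⊔-split m n)

_⇛_ : Region → Region → Region
everywhere ⇛ s          = s
below m    ⇛ everywhere = everywhere
below m    ⇛ below n with n <? m
... | yes _ = below n
... | no  _ = everywhere

-- When n < m, the point n refutes below m ⇛ below n, and so does every point beneath it.
∈-⇛ : ∀ r s w → (∀ v → w ≼ v → v ∈ r → v ∈ s) ⇔ w ∈ (r ⇛ s)
∈-⇛ everywhere s w = mk⇔ (λ r⊆s → r⊆s w ≼-refl tt) (λ w∈s v w≼v _ → ∈-upward s w≼v w∈s)
∈-⇛ (below m) everywhere w = mk⇔ (λ _ → tt) (λ _ _ _ _ → tt)
∈-⇛ (below m) (below n) w with n <? m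
... | yes n<m = mk⇔ refuted-beneath-n (λ w∈s v w≼v _ → ∈-upward (below n) w≼v w∈s)
  where
  refuted-beneath-n : (∀ v → w ≼ v → v ∈ below m → v ∈ below n) → w ∈ below n
  refuted-beneath-n r⊆s with ∈-below-or-≼ n w
  ... | inj₁ w∈s  = w∈s
  ... | inj₂ w≼n = ⊥-elim (<-irrefl refl (r⊆s (fin n) w≼n n<m))
... | no  n≮m = mk⇔ (λ _ → tt) (λ _ v _ v∈r → widen v v∈r)
  where
  widen : ∀ v → v ∈ below m → v ∈ below n
  widen (fin d) d<m = <-≤-trans d<m (≮⇒≥ n≮m)

next : Region → Region
next everywhere      = everywhere
next (below zero)    = below zero
next (below (suc n)) = below (suc (suc n))

∈-next : ∀ r w → step w ∈ r ⇔ w ∈ next r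
∈-next everywhere      w             = mk⇔ (λ _ → tt) (λ _ → tt)
∈-next (below zero)    ∞             = mk⇔ (λ ()) (λ ())
∈-next (below zero)    (fin d)       = mk⇔ (λ ()) (λ ())
∈-next (below (suc n)) ∞             = mk⇔ (λ ()) (λ ())
∈-next (below (suc n)) (fin zero)    = mk⇔ (λ _ → z<s) (λ _ → z<s)
∈-next (below (suc n)) (fin (suc d)) = mk⇔ s≤s s≤s⁻¹

_Defines_ : Fm → Region → Set
φ Defines r = ∀ w → w ⊩ φ ⇔ w ∈ r

var-defines : ∀ x → var x Defines below 1
var-defines x ∞       = mk⇔ (λ ()) (λ ())
var-defines x (fin d) = mk⇔ (λ { refl → z<s }) (λ { (s≤s z≤n) → refl })

⊥-defines : ⊥' Defines below 0
⊥-defines ∞       = mk⇔ (λ ()) (λ ())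
⊥-defines (fin d) = mk⇔ (λ ()) (λ ())

∧-defines : ∀ {φ ψ r s} → φ Defines r → ψ Defines s → (φ ∧' ψ) Defines (r ∩ s)
∧-defines {r = r} {s} φ≡r ψ≡s w = ∈-∩ r s w ⇔-∘ (φ≡r w ×-⇔ ψ≡s w)

∨-defines : ∀ {φ ψ r s} → φ Defines r → ψ Defines s → (φ ∨' ψ) Defines (r ∪ s)
∨-defines {r = r} {s} φ≡r ψ≡s w = ∈-∪ r s w ⇔-∘ (φ≡r w ⊎-⇔ ψ≡s w)

⇒-defines : ∀ {φ ψ r s} → φ Defines r → ψ Defines s → (φ ⇒ ψ) Defines (r ⇛ s)
⇒-defines {r = r} {s} φ≡r ψ≡s w = ∈-⇛ r s w ⇔-∘ mk⇔
  (λ w⊩φ⇒ψ v w≼v v∈r → to (ψ≡s v) (w⊩φ⇒ψ v w≼v (from (φ≡r v) v∈r)))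
  (λ r⊆s v w≼v v⊩φ → from (ψ≡s v) (r⊆s v w≼v (to (φ≡r v) v⊩φ)))

○-defines : ∀ {φ r} → φ Defines r → (○ φ) Defines next r
○-defines {r = r} φ≡r w = ∈-next r w ⇔-∘ φ≡r (step w)

R-defines : ∀ {ψ s} φ → ψ Defines s → (φ R ψ) Defines s
R-defines {ψ} {s} φ ψ≡s w = mk⇔ at-now everywhere-later
  where
  at-now : w ⊩ (φ R ψ) → w ∈ s
  at-now w⊩φRψ with w⊩φRψ zero
  ... | inj₁ w⊩ψ       = to (ψ≡s w) w⊩ψ
  ... | inj₂ (_ , () , _)
  everywhere-later : w ∈ s → w ⊩ (φ R ψ)
  everywhere-later w∈s k = inj₁ (from (ψ≡s (iter step k w)) (∈-iter-step s k w w∈s))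

LR-definable : ∀ {φ} → InLR φ → Σ Region (φ Defines_)
LR-definable (var x) = below 1 , var-defines x
LR-definable ⊥'      = below 0 , ⊥-defines
LR-definable (_∧'_ {φ} {ψ} i j) with LR-definable i | LR-definable j
... | r , φ≡r | s , ψ≡s = r ∩ s , ∧-defines {φ} {ψ} φ≡r ψ≡s
LR-definable (_∨'_ {φ} {ψ} i j) with LR-definable i | LR-definable j
... | r , φ≡r | s , ψ≡s = r ∪ s , ∨-defines {φ} {ψ} φ≡r ψ≡s
LR-definable (_⇒_ {φ} {ψ} i j) with LR-definable i | LR-definable j
... | r , φ≡r | s , ψ≡s = r ⇛ s , ⇒-defines {φ} {ψ} φ≡r ψ≡s
LR-definable (○_ {φ} i) with LR-definable i
... | r , φ≡r = next r , ○-defines {φ} φ≡r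
LR-definable (_R_ {φ} {ψ} _ j) with LR-definable j
... | s , ψ≡s = s , R-defines {ψ} φ ψ≡s

◇-var-undefinable : ∀ p r → ¬ ((◇ var p) Defines r)
◇-var-undefinable p everywhere ◇p≡r = ¬◇-var-at-∞ p (from (◇p≡r ∞) tt)
◇-var-undefinable p (below n)  ◇p≡r = <-irrefl refl (to (◇p≡r (fin n)) (◇-var-at-fin p n))

theorem8p13 : (p : Var) → ¬ Σ Fm (λ φ → InLR φ × Valid ((◇ var p) ⇔' φ))
theorem8p13 p (φ , φ∈LR , valid) with LR-definable φ∈LR
... | r , φ≡r = ◇-var-undefinable p r λ w → φ≡r w ⇔-∘ valid-⇔'-pointwise {◇ var p} {φ} valid countdown w
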